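{- Let $d,\ell,\ell'$ be positive integers with $d\geq 3$, and let $f:[\ell]\times\{2,\dots,d-1\}\to\{+,0,-\}$ and $f':[\ell']\times\{2,\dots,d-1\}\to\{+,0,-\}$. Then $$|\mathrm{Hom}(S(d,\ell,f),S(d,\ell',f'))|=\begin{cases}2 & \text{if } \ell=\ell',\ f\leq f' \text{ and } \mathrm{inv}f\leq f',\\ 1 & \text{otherwise, if } \ell=\ell' \text{ and either } f\leq f' \text{ or } \mathrm{inv}f\leq f',\\ 0 & \text{in the rest of the cases.}\end{cases}$$
   Context: Digraphs are finite sets with a binary relation (arcs); a homomorphism of digraphs is a map of vertices sending arcs to arcs, and $\mathrm{Hom}(D,D')$ is the set of homomorphisms. $[k]=\{1,\dots,k\}$. A transitive tournament $T$ on $k$ vertices has vertices $v_1(T),\dots,v_k(T)$ and arcs $(v_a(T),v_b(T))$ for all $a<b$. Given $d\geq 3$, $\ell\geq 1$ and $f:[\ell]\times\{2,\dots,d-1\}\to\{+,0,-\}$, the digraph $S(d,\ell,f)$ is defined as follows. Take $2\ell$ disjoint transitive tournaments on $d$ vertices $T_+^1,\dots,T_+^\ell,T_-^1,\dots,T_-^\ell$, two transitive tournaments $T_l,T_r$ on $d-1$ vertices, and four further vertices $s_l,t_l,s_r,t_r$, all pairwise disjoint. The vertex set is the union of all these. The arcs are: all arcs of all the tournaments; $(s_l,x),(x,t_l)$ for $x\in V(T_l)$; $(s_r,x),(x,t_r)$ for $x\in V(T_r)$; the arcs $(v_d(T_+^1),s_l)$, $(t_l,v_1(T_-^1))$, $(v_d(T_-^\ell),s_r)$,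 $(t_r,v_1(T_+^\ell))$; for $1\leq i\leq \ell-1$ the arcs $(v_d(T_+^{i+1}),v_1(T_+^i))$ and $(v_d(T_-^i),v_1(T_-^{i+1}))$; for $1\leq i\leq\ell$ and $2\leq j\leq d-1$ the arc $(v_j(T_+^i),v_{d+1-j}(T_-^i))$ if $f(i,j)=-$, and the arc $(v_{d+1-j}(T_-^i),v_j(T_+^i))$ if $f(i,j)=+$ (no arc if $f(i,j)=0$). For two maps $f,f'$ with the same domain $[\ell]\times\{2,\dots,d-1\}$, write $f\leq f'$ if for every $(i,j)$ either $f(i,j)=0$ or $f(i,j)=f'(i,j)$ (when the domains differ, $f\leq f'$ does not hold). The map $\mathrm{inv}f:[\ell]\times\{2,\dots,d-1\}\to\{+,0,-\}$ is $(\mathrm{inv}f)(i,j)=-f(\ell+1-i,d+1-j)$, where $-(+)=-$, $-(0)=0$, $-(-)=+$. -}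

module Defs where

open import Level using (0ℓ)
open import Data.Nat using (ℕ; zero; suc; _+_; _∸_; _<_)
open import Data.Fin using (Fin; toℕ; opposite)
open import Data.Product using (_×_; Σ; proj₁)
open import Data.Sum using (_⊎_)
open import Relation.Binary.PropositionalEquality using (_≡_; refl; sym; trans)
open import Relation.Binary.Bundles using (Setoid)
open import Function.Bundles using (Bijection)
import Relation.Binary.PropositionalEquality as P

record Digraph : Set₁ where
  field
    V   : Set
    Arc : V → V → Set
open Digraph public

Hom : Digraph → Digraph → Set
Hom D E = Σ (V D → V E) (λ h → ∀ {x y} → Arc D x y → Arc E (h x) (h y))

_≈H_ : ∀ {D E} → Hom D E → Hom D E → Set
_≈H_ {D} h h' = ∀ (x : V D) → proj₁ h x ≡ proj₁ h' x

HomSetoid : Digraph → Digraph → Setoid 0ℓ 0ℓ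
HomSetoid D E = record
  { Carrier = Hom D E
  ; _≈_ = _≈H_ {D} {E}
  ; isEquivalence = record
    { refl = λ x → refl
    ; sym = λ p x → sym (p x)
    ; trans = λ p q x → trans (p x) (q x) } }

HomCount : Digraph → Digraph → ℕ → Set
HomCount D E k = Bijection (P.setoid (Fin k)) (HomSetoid D E)

data Sign : Set where
  pos zer neg : Sign

negS : Sign → Sign
negS pos = neg
negS zer = zer
negS neg = pos

-- A map f : [ℓ] × {2,…,d-1} → {+,0,-}, 0-based: (i , j') ↦ (i+1 , j'+2).
SignMap : ℕ → ℕ → Set
SignMap d ℓ = Fin ℓ → Fin (d ∸ 2) → Sign

Leq : ∀ d {ℓ ℓ'} → SignMap d ℓ → SignMap d ℓ' → Set
Leq d {ℓ} {ℓ'} f f' =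
  ℓ ≡ ℓ' × (∀ (i : Fin ℓ) (i' : Fin ℓ') (j : Fin (d ∸ 2)) → toℕ i ≡ toℕ i' →
             f i j ≡ zer ⊎ f i j ≡ f' i' j)

-- (inv f)(i,j) = - f(ℓ+1-i, d+1-j); in 0-based indices both are `opposite`.
inv : ∀ d {ℓ} → SignMap d ℓ → SignMap d ℓ
inv d f i j = negS (f (opposite i) (opposite j))

-- Vertices of S(d,ℓ,f); tournament vertex v_a is encoded by index a-1.
data SV (d ℓ : ℕ) : Set where
  plus  : Fin ℓ → Fin d → SV d ℓ
  minus : Fin ℓ → Fin d → SV d ℓ
  lft   : Fin (d ∸ 1) → SV d ℓ
  rgt   : Fin (d ∸ 1) → SV d ℓ
  sl tl sr tr : SV d ℓ

data SArc (d ℓ : ℕ) (f : SignMap d ℓ) : SV d ℓ → SV d ℓ → Set where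
  tp : ∀ i (a b : Fin d) → toℕ a < toℕ b → SArc d ℓ f (plus i a) (plus i b)
  tm : ∀ i (a b : Fin d) → toℕ a < toℕ b → SArc d ℓ f (minus i a) (minus i b)
  tL : ∀ (a b : Fin (d ∸ 1)) → toℕ a < toℕ b → SArc d ℓ f (lft a) (lft b)
  tR : ∀ (a b : Fin (d ∸ 1)) → toℕ a < toℕ b → SArc d ℓ f (rgt a) (rgt b)
  sL : ∀ x → SArc d ℓ f sl (lft x)
  Lt : ∀ x → SArc d ℓ f (lft x) tl
  sR : ∀ x → SArc d ℓ f sr (rgt x)
  Rt : ∀ x → SArc d ℓ f (rgt x) tr
  e1 : ∀ i a → toℕ i ≡ 0 → toℕ a ≡ d ∸ 1 → SArc d ℓ f (plus i a) sl
  e2 : ∀ i b → toℕ i ≡ 0 → toℕ b ≡ 0 → SArc d ℓ f tl (minus i b)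
  e3 : ∀ i a → toℕ i ≡ ℓ ∸ 1 → toℕ a ≡ d ∸ 1 → SArc d ℓ f (minus i a) sr
  e4 : ∀ i b → toℕ i ≡ ℓ ∸ 1 → toℕ b ≡ 0 → SArc d ℓ f tr (plus i b)
  cp : ∀ i i' a b → toℕ i' ≡ suc (toℕ i) → toℕ a ≡ d ∸ 1 → toℕ b ≡ 0 →
       SArc d ℓ f (plus i' a) (plus i b)
  cm : ∀ i i' a b → toℕ i' ≡ suc (toℕ i) → toℕ a ≡ d ∸ 1 → toℕ b ≡ 0 →
       SArc d ℓ f (minus i a) (minus i' b)
  -- j = j'+2: v_j has index j'+1, v_{d+1-j} has index d-(j'+2)
  -- f(i,j) = - : (v_j(T_+^i), v_{d+1-j}(T_-^i))
  fm : ∀ i (j : Fin (d ∸ 2)) a b → f i j ≡ neg →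
       toℕ a ≡ suc (toℕ j) → toℕ b ≡ d ∸ (toℕ j + 2) →
       SArc d ℓ f (plus i a) (minus i b)
  fp : ∀ i (j : Fin (d ∸ 2)) a b → f i j ≡ pos →
       toℕ a ≡ suc (toℕ j) → toℕ b ≡ d ∸ (toℕ j + 2) →
       SArc d ℓ f (minus i b) (plus i a)

S : (d ℓ : ℕ) → SignMap d ℓ → Digraph
S d ℓ f = record { V = SV d ℓ ; Arc = SArc d ℓ f }

{-# OPTIONS --safe #-}
module Submission where

-- The vertices of S(d, ℓ, f) form a cycle of 2ℓ + 2 blocks T₊ℓ, …, T₊¹, (s_l, T_l, t_l),
-- T₋¹, …, T₋ℓ, (s_r, T_r, t_r), the top of each linked to the bottom of the next; every block
-- is transitive except that the two gadgets lack their arc s → t, and the only other arcs join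
-- a middle vertex of T₊ⁱ to its mirror image in T₋ⁱ.  A homomorphism maps every transitive
-- triangle into one block, hence each block into one block with strictly increasing levels.
-- Blocks have d or d + 1 levels, so links go to links, bottoms to bottoms and tops to tops,
-- and gadgets correspond to gadgets.  On the cycle of blocks the homomorphism thus commutes
-- with the successor and preserves the gadgets, which forces ℓ = ℓ' and leaves only the
-- identity and the half turn T₊ⁱ ↔ T₋^(ℓ+1-i).  The identity is a homomorphism iff f ≤ f', the
-- half turn iff inv f ≤ f'.

open import Defs
open import Data.Nat using (ℕ; zero; suc; _+_; _∸_; _≤_; _<_; z≤n; s≤s; s≤s⁻¹; _≟_; _≤?_)
open import Data.Nat.Properties
open import Data.Fin using (Fin; toℕ; opposite; inject₁) renaming (zero to fzero; suc to fsuc)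
open import Data.Fin.Properties using (toℕ-injective; toℕ<n; toℕ-inject₁; opposite-prop; opposite-involutive)
open import Data.Product using (Σ; _×_; _,_; proj₁; proj₂)
open import Data.Sum using (_⊎_; inj₁; inj₂; [_,_])
import Data.Sum as Sum
open import Data.Empty using (⊥; ⊥-elim)
open import Relation.Nullary using (¬_; Dec; yes; no)
open import Relation.Nullary.Decidable using (_⊎-dec_)
open import Relation.Binary.Bundles using (Setoid)
open import Relation.Binary.PropositionalEquality hiding ([_])
open import Function.Base using (_∘_)
open import Function.Bundles using (Bijection)
module _ {c r} (A : Setoid c r) where
  open Setoid A using (Carrier; _≈_) renaming (refl to ≈-refl; sym to ≈-sym)

  Fin0-bijection : (Carrier → ⊥) → Bijection (setoid (Fin 0)) A
  Fin0-bijection empty = record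
    { to = λ ()
    ; cong = λ { {()} }
    ; bijective = (λ { {()} }) , λ y → ⊥-elim (empty y)
    }

  Fin1-bijection : (x : Carrier) → (∀ y → x ≈ y) → Bijection (setoid (Fin 1)) A
  Fin1-bijection x unique = record
    { to = λ _ → x
    ; cong = λ _ → ≈-refl
    ; bijective = (λ { {fzero} {fzero} _ → refl }) , λ y → fzero , λ _ → unique y
    }

  Fin2-bijection : (x y : Carrier) → ¬ x ≈ y → (∀ z → x ≈ z ⊎ y ≈ z) →
                   Bijection (setoid (Fin 2)) A
  Fin2-bijection x y x≉y cover = record
    { to = to
    ; cong = λ { refl → ≈-refl }
    ; bijective = injective , surjective
    }
    where
    to : Fin 2 → Carrier
    to fzero = x
    to (fsuc _) = y

    injective : ∀ {i j} → to i ≈ to j → i ≡ j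
    injective {fzero} {fzero} _ = refl
    injective {fzero} {fsuc fzero} x≈y = ⊥-elim (x≉y x≈y)
    injective {fsuc fzero} {fzero} y≈x = ⊥-elim (x≉y (≈-sym y≈x))
    injective {fsuc fzero} {fsuc fzero} _ = refl

    surjective : ∀ z → Σ (Fin 2) λ i → ∀ {j} → j ≡ i → to j ≈ z
    surjective z with cover z
    ... | inj₁ x≈z = fzero , λ { refl → x≈z }
    ... | inj₂ y≈z = fsuc fzero , λ { refl → y≈z }

clamp : (m : ℕ) → ℕ → Fin (suc m)
clamp zero _ = fzero
clamp (suc m) zero = fzero
clamp (suc m) (suc p) = fsuc (clamp m p)

toℕ-clamp : ∀ {m p} → p ≤ m → toℕ (clamp m p) ≡ p
toℕ-clamp {zero} z≤n = refl
toℕ-clamp {suc m} z≤n = refl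
toℕ-clamp {suc m} (s≤s p≤m) = cong suc (toℕ-clamp p≤m)

clamp-toℕ : ∀ {m} (i : Fin (suc m)) → clamp m (toℕ i) ≡ i
clamp-toℕ {zero} fzero = refl
clamp-toℕ {suc m} fzero = refl
clamp-toℕ {suc m} (fsuc i) = cong fsuc (clamp-toℕ i)

clamp-mono : ∀ {m p q} → p < q → q ≤ m → toℕ (clamp m p) < toℕ (clamp m q)
clamp-mono p<q q≤m = subst₂ _<_ (sym (toℕ-clamp (≤-trans (<⇒≤ p<q) q≤m))) (sym (toℕ-clamp q≤m)) p<q

suc[m∸1+n]≡m∸n : ∀ {m n} → n < m → suc (m ∸ suc n) ≡ m ∸ n
suc[m∸1+n]≡m∸n n<m = sym (+-∸-assoc 1 n<m)

last-index : ∀ {ℓ} (i : Fin ℓ) → toℕ i ≡ ℓ ∸ 1 → suc (toℕ i) ≡ ℓ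
last-index {suc ℓ} _ i≡ℓ = cong suc i≡ℓ

opposite-first : ∀ {ℓ} (i : Fin ℓ) → toℕ i ≡ 0 → toℕ (opposite i) ≡ ℓ ∸ 1
opposite-first {ℓ} i i≡0 = trans (opposite-prop i) (cong (λ c → ℓ ∸ suc c) i≡0)

opposite-last : ∀ {ℓ} (i : Fin ℓ) → toℕ i ≡ ℓ ∸ 1 → toℕ (opposite i) ≡ 0
opposite-last {ℓ} i i≡last = trans (opposite-prop i) (trans (cong (ℓ ∸_) (last-index i i≡last)) (n∸n≡0 ℓ))

opposite-suc : ∀ {ℓ} (i i' : Fin ℓ) → toℕ i' ≡ suc (toℕ i) → toℕ (opposite i) ≡ suc (toℕ (opposite i'))
opposite-suc {ℓ} i i' i'≡1+i = begin
  toℕ (opposite i)             ≡⟨ opposite-prop i ⟩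
  ℓ ∸ suc (toℕ i)              ≡⟨ sym (suc[m∸1+n]≡m∸n (subst (_< ℓ) i'≡1+i (toℕ<n i'))) ⟩
  suc (ℓ ∸ suc (suc (toℕ i)))  ≡⟨ cong (λ c → suc (ℓ ∸ suc c)) (sym i'≡1+i) ⟩
  suc (ℓ ∸ suc (toℕ i'))       ≡⟨ cong suc (sym (opposite-prop i')) ⟩
  suc (toℕ (opposite i'))      ∎
  where open ≡-Reasoning

Leq-nonzero : ∀ {d ℓ} {f f' : SignMap d ℓ} → Leq d f f' → ∀ {i j s} → f i j ≡ s → s ≢ zer → f' i j ≡ s
Leq-nonzero (_ , f≤f') {i} {j} f≡s s≢0 with f≤f' i i j refl
... | inj₁ f≡0 = ⊥-elim (s≢0 (trans (sym f≡s) f≡0))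
... | inj₂ f≡f' = trans (sym f≡f') f≡s

inv-nonzero : ∀ {d ℓ} {f f' : SignMap d ℓ} → Leq d (inv d f) f' →
              ∀ {i j s} → f i j ≡ s → negS s ≢ zer → f' (opposite i) (opposite j) ≡ negS s
inv-nonzero {d} {f = f} inv≤f' {i} {j} f≡s = Leq-nonzero {d} inv≤f'
  (cong negS (trans (cong₂ f (opposite-involutive i) (opposite-involutive j)) f≡s))

cycleSuc : ℕ → ℕ → ℕ
cycleSuc m c with c ≟ m
... | yes _ = 0
... | no _ = suc c

cycleSuc-< : ∀ {m c} → c < m → cycleSuc m c ≡ suc c
cycleSuc-< {m} {c} c<m with c ≟ m
... | yes refl = ⊥-elim (<-irrefl refl c<m)
... | no _ = refl

cycleSuc-last : ∀ m → cycleSuc m m ≡ 0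
cycleSuc-last m with m ≟ m
... | yes _ = refl
... | no m≢m = ⊥-elim (m≢m refl)

cycleSuc-≢ : ∀ {m} c → cycleSuc (suc m) c ≢ c
cycleSuc-≢ {m} c with c ≟ suc m
... | yes c≡1+m = λ 0≡c → 0≢1+n (trans 0≡c c≡1+m)
... | no _ = 1+n≢n

cycleSuc-suc : ∀ {m c c'} → suc c ≡ c' → c < m → c' ≡ cycleSuc m c
cycleSuc-suc refl c<m = sym (cycleSuc-< c<m)

lastBlock : ℕ → ℕ
lastBlock ℓ = suc (ℓ + ℓ)

GadgetBlock : ℕ → ℕ → Set
GadgetBlock ℓ k = k ≡ ℓ ⊎ k ≡ lastBlock ℓ

gadgetBlock? : ∀ ℓ k → Dec (GadgetBlock ℓ k)
gadgetBlock? ℓ k = (k ≟ ℓ) ⊎-dec (k ≟ lastBlock ℓ)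

ℓ<lastBlock : ∀ ℓ → ℓ < lastBlock ℓ
ℓ<lastBlock ℓ = s≤s (m≤m+n ℓ ℓ)

gadget-offset : ∀ a {m} → GadgetBlock a (a + suc m) → m ≡ a
gadget-offset a (inj₁ a+1+m≡a) = ⊥-elim (m+1+n≢m a a+1+m≡a)
gadget-offset a {m} (inj₂ a+1+m≡last) =
  +-cancelˡ-≡ a m a (suc-injective (trans (sym (+-suc a m)) a+1+m≡last))

halfTurn : ℕ → ℕ → ℕ
halfTurn a k with k ≤? a
... | yes _ = suc a + k
... | no _ = k ∸ suc a

halfTurn-≤ : ∀ {a k} → k ≤ a → halfTurn a k ≡ suc a + k
halfTurn-≤ {a} {k} k≤a with k ≤? a
... | yes _ = refl
... | no k≰a = ⊥-elim (k≰a k≤a)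

halfTurn-> : ∀ {a k} → a < k → halfTurn a k ≡ k ∸ suc a
halfTurn-> {a} {k} a<k with k ≤? a
... | yes k≤a = ⊥-elim (<⇒≱ a<k k≤a)
... | no _ = refl

-- The two gadget blocks are half a turn apart on both cycles, so a successor-preserving
-- map that preserves them in both directions forces a ≡ b and is a rotation by 0 or a + 1.
module CyclicMap {a b : ℕ} (C : ℕ → ℕ)
  (C-suc : ∀ k → k < lastBlock a → C (suc k) ≡ cycleSuc (lastBlock b) (C k))
  (C-wrap : C 0 ≡ cycleSuc (lastBlock b) (C (lastBlock a)))
  (gadget⇒gadget : ∀ k → k ≤ lastBlock a → GadgetBlock a k → GadgetBlock b (C k))
  (gadget⇐gadget : ∀ k → k ≤ lastBlock a → GadgetBlock b (C k) → GadgetBlock a k)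
  where

  open ≡-Reasoning

  walk : ∀ {s t} m → C s ≡ t → s + m ≤ lastBlock a → t + m ≤ lastBlock b → C (s + m) ≡ t + m
  walk {s} {t} zero Cs≡t _ _ = trans (cong C (+-identityʳ s)) (trans Cs≡t (sym (+-identityʳ t)))
  walk {s} {t} (suc m) Cs≡t s+1+m≤ t+1+m≤ = begin
    C (s + suc m)          ≡⟨ cong C (+-suc s m) ⟩
    C (suc (s + m))        ≡⟨ C-suc (s + m) s+m< ⟩
    cycleSuc _ (C (s + m))     ≡⟨ cong (cycleSuc _) (walk m Cs≡t (<⇒≤ s+m<) (<⇒≤ t+m<)) ⟩
    cycleSuc _ (t + m)         ≡⟨ cycleSuc-< t+m< ⟩
    suc (t + m)            ≡⟨ sym (+-suc t m) ⟩
    t + suc m              ∎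
    where
    s+m< : s + m < lastBlock a
    s+m< = subst (_≤ lastBlock a) (+-suc s m) s+1+m≤
    t+m< : t + m < lastBlock b
    t+m< = subst (_≤ lastBlock b) (+-suc t m) t+1+m≤

  a≤lastBlock : a ≤ lastBlock a
  a≤lastBlock = <⇒≤ (ℓ<lastBlock a)

  C-a : C a ≡ b ⊎ C a ≡ lastBlock b
  C-a = gadget⇒gadget a a≤lastBlock (inj₁ refl)

  C-1+a+m : C a ≡ lastBlock b → ∀ m → m ≤ a → m ≤ lastBlock b → C (suc a + m) ≡ m
  C-1+a+m Ca≡last m m≤a m≤last = walk m C1+a≡0 (s≤s (+-monoʳ-≤ a m≤a)) m≤last
    where
    C1+a≡0 : C (suc a) ≡ 0
    C1+a≡0 = begin
      C (suc a)                ≡⟨ C-suc a (ℓ<lastBlock a) ⟩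
      cycleSuc _ (C a)             ≡⟨ cong (cycleSuc _) Ca≡last ⟩
      cycleSuc _ (lastBlock b)     ≡⟨ cycleSuc-last (lastBlock b) ⟩
      0                        ∎

  a≡b : a ≡ b
  a≡b with C-a | ≤-total a b
  ... | inj₁ Ca≡b | inj₁ a≤b =
        gadget-offset b (subst (GadgetBlock b) Clast≡ (gadget⇒gadget _ ≤-refl (inj₂ refl)))
    where
    Clast≡ : C (lastBlock a) ≡ b + suc a
    Clast≡ = trans (cong C (sym (+-suc a a)))
      (walk (suc a) Ca≡b (≤-reflexive (+-suc a a)) (≤-trans (+-monoʳ-≤ b (s≤s a≤b)) (≤-reflexive (+-suc b b))))
  ... | inj₁ Ca≡b | inj₂ b≤a = sym (gadget-offset a (gadget⇐gadget _ a+1+b≤ (inj₂ Ck≡last)))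
    where
    a+1+b≤ : a + suc b ≤ lastBlock a
    a+1+b≤ = ≤-trans (+-monoʳ-≤ a (s≤s b≤a)) (≤-reflexive (+-suc a a))
    Ck≡last : C (a + suc b) ≡ lastBlock b
    Ck≡last = trans (walk (suc b) Ca≡b a+1+b≤ (≤-reflexive (+-suc b b))) (+-suc b b)
  ... | inj₂ Ca≡last | inj₁ a≤b =
        [ (λ a≡b → a≡b) , (λ a≡last → ⊥-elim (<⇒≢ (≤-<-trans a≤b (ℓ<lastBlock b)) a≡last)) ]
          (subst (GadgetBlock b) (C-1+a+m Ca≡last a ≤-refl (≤-trans a≤b (<⇒≤ (ℓ<lastBlock b))))
                 (gadget⇒gadget _ ≤-refl (inj₂ refl)))
  ... | inj₂ Ca≡last | inj₂ b≤a =
        [ (λ 1+a+b≡a → ⊥-elim (<⇒≢ (s≤s (m≤m+n a b)) (sym 1+a+b≡a)))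
        , (λ 1+a+b≡last → sym (+-cancelˡ-≡ a b a (suc-injective 1+a+b≡last))) ]
          (gadget⇐gadget (suc a + b) (s≤s (+-monoʳ-≤ a b≤a))
                         (inj₁ (C-1+a+m Ca≡last b b≤a (<⇒≤ (ℓ<lastBlock b)))))

  identity-or-halfTurn : a ≡ b → (∀ k → k ≤ lastBlock a → C k ≡ k)
                               ⊎ (∀ k → k ≤ lastBlock a → C k ≡ halfTurn a k)
  identity-or-halfTurn refl with C-a
  ... | inj₁ Ca≡a = inj₁ λ k k≤ → walk k C0≡0 k≤ k≤
    where
    Clast≡last : C (lastBlock a) ≡ lastBlock a
    Clast≡last = begin
      C (lastBlock a)    ≡⟨ cong C (sym (+-suc a a)) ⟩
      C (a + suc a)      ≡⟨ walk (suc a) Ca≡a (≤-reflexive (+-suc a a)) (≤-reflexive (+-suc a a)) ⟩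
      a + suc a          ≡⟨ +-suc a a ⟩
      lastBlock a        ∎
    C0≡0 : C 0 ≡ 0
    C0≡0 = trans C-wrap (trans (cong (cycleSuc _) Clast≡last) (cycleSuc-last _))
  ... | inj₂ Ca≡last = inj₂ C≡halfTurn
    where
    C0≡1+a : C 0 ≡ suc a
    C0≡1+a = begin
      C 0                        ≡⟨ C-wrap ⟩
      cycleSuc _ (C (suc a + a))     ≡⟨ cong (cycleSuc _) (C-1+a+m Ca≡last a ≤-refl a≤lastBlock) ⟩
      cycleSuc _ a                   ≡⟨ cycleSuc-< (ℓ<lastBlock a) ⟩
      suc a                      ∎
    C≡halfTurn : ∀ k → k ≤ lastBlock a → C k ≡ halfTurn a k
    C≡halfTurn k k≤ with ≤-<-connex k a
    ... | inj₁ k≤a = trans (walk k C0≡1+a k≤ (s≤s (+-monoʳ-≤ a k≤a))) (sym (halfTurn-≤ k≤a))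
    ... | inj₂ a<k = begin
      C k                        ≡⟨ cong C (sym (m+[n∸m]≡n a<k)) ⟩
      C (suc a + (k ∸ suc a))    ≡⟨ C-1+a+m Ca≡last (k ∸ suc a) k∸1+a≤a (≤-trans k∸1+a≤a a≤lastBlock) ⟩
      k ∸ suc a                  ≡⟨ sym (halfTurn-> a<k) ⟩
      halfTurn a k                  ∎
      where
      k∸1+a≤a : k ∸ suc a ≤ a
      k∸1+a≤a = ≤-trans (∸-monoˡ-≤ (suc a) k≤) (≤-reflexive (m+n∸m≡n a a))

module _ (n : ℕ) where

  d : ℕ
  d = suc (suc (suc n))

  -- Blocks in cyclic order: T₊ℓ, …, T₊¹ are 0, …, ℓ-1, the gadget (s_l, T_l, t_l) is ℓ,
  -- T₋¹, …, T₋ℓ are ℓ+1, …, 2ℓ, and the gadget (s_r, T_r, t_r) is 2ℓ+1.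
  block : ∀ {ℓ} → SV d ℓ → ℕ
  block {ℓ} (plus i _) = ℓ ∸ suc (toℕ i)
  block {ℓ} (minus i _) = suc (ℓ + toℕ i)
  block {ℓ} (lft _) = ℓ
  block {ℓ} sl = ℓ
  block {ℓ} tl = ℓ
  block {ℓ} (rgt _) = lastBlock ℓ
  block {ℓ} sr = lastBlock ℓ
  block {ℓ} tr = lastBlock ℓ

  level : ∀ {ℓ} → SV d ℓ → ℕ
  level (plus _ a) = toℕ a
  level (minus _ a) = toℕ a
  level (lft u) = suc (toℕ u)
  level (rgt u) = suc (toℕ u)
  level sl = 0
  level sr = 0
  level tl = d
  level tr = d

  height : ∀ {ℓ} → SV d ℓ → ℕ
  height (plus _ _) = suc (suc n)
  height (minus _ _) = suc (suc n)
  height (lft _) = d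
  height (rgt _) = d
  height sl = d
  height sr = d
  height tl = d
  height tr = d

  blockHeight : ℕ → ℕ → ℕ
  blockHeight ℓ k with gadgetBlock? ℓ k
  ... | yes _ = d
  ... | no _ = suc (suc n)

  blockHeight-gadget : ∀ {ℓ k} → GadgetBlock ℓ k → blockHeight ℓ k ≡ d
  blockHeight-gadget {ℓ} {k} gadget with gadgetBlock? ℓ k
  ... | yes _ = refl
  ... | no ¬gadget = ⊥-elim (¬gadget gadget)

  blockHeight-left : ∀ ℓ → blockHeight ℓ ℓ ≡ d
  blockHeight-left ℓ = blockHeight-gadget (inj₁ refl)

  blockHeight-right : ∀ ℓ → blockHeight ℓ (lastBlock ℓ) ≡ d
  blockHeight-right ℓ = blockHeight-gadget (inj₂ refl)

  blockHeight-tournament : ∀ {ℓ k} → ¬ GadgetBlock ℓ k → blockHeight ℓ k ≡ suc (suc n)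
  blockHeight-tournament {ℓ} {k} ¬gadget with gadgetBlock? ℓ k
  ... | yes gadget = ⊥-elim (¬gadget gadget)
  ... | no _ = refl

  blockHeight≡d⇒gadget : ∀ {ℓ k} → blockHeight ℓ k ≡ d → GadgetBlock ℓ k
  blockHeight≡d⇒gadget {ℓ} {k} eq with gadgetBlock? ℓ k
  ... | yes gadget = gadget
  ... | no _ = ⊥-elim (1+n≢n (sym eq))

  2+n≤blockHeight : ∀ ℓ k → suc (suc n) ≤ blockHeight ℓ k
  2+n≤blockHeight ℓ k with gadgetBlock? ℓ k
  ... | yes _ = n≤1+n _
  ... | no _ = ≤-refl

  plus-block< : ∀ {ℓ} (i : Fin ℓ) → ℓ ∸ suc (toℕ i) < ℓ
  plus-block< {ℓ} i = subst (_≤ ℓ) (sym (suc[m∸1+n]≡m∸n (toℕ<n i))) (m∸n≤m ℓ (toℕ i))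

  minus-block< : ∀ {ℓ} (i : Fin ℓ) → suc (ℓ + toℕ i) < lastBlock ℓ
  minus-block< {ℓ} i = s≤s (subst (_≤ ℓ + ℓ) (+-suc ℓ (toℕ i)) (+-monoʳ-≤ ℓ (toℕ<n i)))

  plus-block≢minus-block : ∀ {ℓ} (i i' : Fin ℓ) → ℓ ∸ suc (toℕ i) ≢ suc (ℓ + toℕ i')
  plus-block≢minus-block {ℓ} i i' =
    <⇒≢ (<-≤-trans (plus-block< i) (≤-trans (m≤m+n ℓ (toℕ i')) (n≤1+n _)))

  block≤lastBlock : ∀ {ℓ} (x : SV d ℓ) → block x ≤ lastBlock ℓ
  block≤lastBlock {ℓ} (plus i _) = <⇒≤ (<-trans (plus-block< i) (ℓ<lastBlock ℓ))
  block≤lastBlock (minus i _) = <⇒≤ (minus-block< i)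
  block≤lastBlock {ℓ} (lft _) = <⇒≤ (ℓ<lastBlock ℓ)
  block≤lastBlock {ℓ} sl = <⇒≤ (ℓ<lastBlock ℓ)
  block≤lastBlock {ℓ} tl = <⇒≤ (ℓ<lastBlock ℓ)
  block≤lastBlock (rgt _) = ≤-refl
  block≤lastBlock sr = ≤-refl
  block≤lastBlock tr = ≤-refl

  height≡blockHeight : ∀ {ℓ} (x : SV d ℓ) → height x ≡ blockHeight ℓ (block x)
  height≡blockHeight {ℓ} (plus i _) = sym (blockHeight-tournament
    [ <⇒≢ (plus-block< i) , <⇒≢ (<-trans (plus-block< i) (ℓ<lastBlock ℓ)) ])
  height≡blockHeight {ℓ} (minus i _) = sym (blockHeight-tournament
    [ (λ eq → <⇒≢ (s≤s (m≤m+n ℓ (toℕ i))) (sym eq)) , <⇒≢ (minus-block< i) ])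
  height≡blockHeight {ℓ} (lft _) = sym (blockHeight-left ℓ)
  height≡blockHeight {ℓ} sl = sym (blockHeight-left ℓ)
  height≡blockHeight {ℓ} tl = sym (blockHeight-left ℓ)
  height≡blockHeight {ℓ} (rgt _) = sym (blockHeight-right ℓ)
  height≡blockHeight {ℓ} sr = sym (blockHeight-right ℓ)
  height≡blockHeight {ℓ} tr = sym (blockHeight-right ℓ)

  height-block : ∀ {ℓ} {x y : SV d ℓ} → block x ≡ block y → height x ≡ height y
  height-block {x = x} {y} eq =
    trans (height≡blockHeight x) (trans (cong (blockHeight _) eq) (sym (height≡blockHeight y)))

  level≤height : ∀ {ℓ} (x : SV d ℓ) → level x ≤ height x
  level≤height (plus _ a) = s≤s⁻¹ (toℕ<n a)
  level≤height (minus _ a) = s≤s⁻¹ (toℕ<n a)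
  level≤height (lft u) = <⇒≤ (s≤s (toℕ<n u))
  level≤height (rgt u) = <⇒≤ (s≤s (toℕ<n u))
  level≤height sl = z≤n
  level≤height sr = z≤n
  level≤height tl = ≤-refl
  level≤height tr = ≤-refl

  level≤blockHeight : ∀ {ℓ} (x : SV d ℓ) → level x ≤ blockHeight ℓ (block x)
  level≤blockHeight x = subst (level x ≤_) (height≡blockHeight x) (level≤height x)

  height≤d : ∀ {ℓ} (x : SV d ℓ) → height x ≤ d
  height≤d x = subst (_≤ d) (sym (height≡blockHeight x)) (blockHeight≤d _ (block x))
    where
    blockHeight≤d : ∀ ℓ k → blockHeight ℓ k ≤ d
    blockHeight≤d ℓ k with gadgetBlock? ℓ k
    ... | yes _ = ≤-refl
    ... | no _ = n≤1+n _

  2+n≤height : ∀ {ℓ} (x : SV d ℓ) → suc (suc n) ≤ height x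
  2+n≤height x = subst (suc (suc n) ≤_) (sym (height≡blockHeight x)) (2+n≤blockHeight _ (block x))

  InteriorLevel : ℕ → Set
  InteriorLevel p = 0 < p × p < suc (suc n)

  mate : ∀ {ℓ} → SV d ℓ → SV d ℓ
  mate (plus i a) = minus i (opposite a)
  mate (minus i a) = plus i (opposite a)
  mate x = x

  mate-involutive : ∀ {ℓ} (x : SV d ℓ) → mate (mate x) ≡ x
  mate-involutive (plus i a) = cong (plus i) (opposite-involutive a)
  mate-involutive (minus i a) = cong (minus i) (opposite-involutive a)
  mate-involutive (lft _) = refl
  mate-involutive (rgt _) = refl
  mate-involutive sl = refl
  mate-involutive sr = refl
  mate-involutive tl = refl
  mate-involutive tr = refl

  mate-injective : ∀ {ℓ} {x y : SV d ℓ} → mate x ≡ mate y → x ≡ y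
  mate-injective {x = x} {y} eq =
    trans (sym (mate-involutive x)) (trans (cong mate eq) (mate-involutive y))

  mate-mate : ∀ {ℓ} {x y z : SV d ℓ} → y ≡ mate x → z ≡ mate y → z ≡ x
  mate-mate {x = x} y≡mate z≡mate = trans z≡mate (trans (cong mate y≡mate) (mate-involutive x))

  cross-partner : (a b : Fin d) (j : Fin (suc n)) →
                  toℕ a ≡ suc (toℕ j) → toℕ b ≡ d ∸ (toℕ j + 2) → b ≡ opposite a
  cross-partner a b j a≡1+j b≡ = toℕ-injective (begin
    toℕ b                   ≡⟨ b≡ ⟩
    d ∸ (toℕ j + 2)         ≡⟨ cong (d ∸_) (+-comm (toℕ j) 2) ⟩
    d ∸ suc (suc (toℕ j))   ≡⟨ cong (λ c → d ∸ suc c) (sym a≡1+j) ⟩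
    d ∸ suc (toℕ a)         ≡⟨ sym (opposite-prop a) ⟩
    toℕ (opposite a)        ∎)
    where open ≡-Reasoning

  interior-suc : (j : Fin (suc n)) → InteriorLevel (suc (toℕ j))
  interior-suc j = s≤s z≤n , s≤s (toℕ<n j)

  interior-opposite : (a : Fin d) (j : Fin (suc n)) → toℕ a ≡ suc (toℕ j) →
                      InteriorLevel (toℕ (opposite a))
  interior-opposite a j a≡1+j rewrite opposite-prop a | a≡1+j =
    m<n⇒0<n∸m (toℕ<n j) , s≤s (m∸n≤m (suc n) (toℕ j))

  data CrossSign {ℓ} (f : SignMap d ℓ) : SV d ℓ → SV d ℓ → Set where
    downward : ∀ i j a b → f i j ≡ neg → toℕ a ≡ suc (toℕ j) → CrossSign f (plus i a) (minus i b)
    upward   : ∀ i j a b → f i j ≡ pos → toℕ a ≡ suc (toℕ j) → CrossSign f (minus i b) (plus i a)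

  data ArcKind {ℓ} (f : SignMap d ℓ) (x y : SV d ℓ) : Set where
    inBlock : block x ≡ block y → level x < level y → ArcKind f x y
    link    : block y ≡ cycleSuc (lastBlock ℓ) (block x) → level y ≡ 0 → level x ≡ height x →
              ArcKind f x y
    cross   : block x ≢ block y → y ≡ mate x → InteriorLevel (level x) →
              InteriorLevel (level y) → CrossSign f x y → ArcKind f x y

  arcKind : ∀ {ℓ} {f : SignMap d ℓ} {x y} → SArc d ℓ f x y → ArcKind f x y
  arcKind (tp _ _ _ a<b) = inBlock refl a<b
  arcKind (tm _ _ _ a<b) = inBlock refl a<b
  arcKind (tL _ _ a<b) = inBlock refl (s≤s a<b)
  arcKind (tR _ _ a<b) = inBlock refl (s≤s a<b)
  arcKind (sL _) = inBlock refl (s≤s z≤n)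
  arcKind (Lt u) = inBlock refl (s≤s (toℕ<n u))
  arcKind (sR _) = inBlock refl (s≤s z≤n)
  arcKind (Rt u) = inBlock refl (s≤s (toℕ<n u))
  arcKind {ℓ} (e1 i _ i≡0 a≡top) = link
    (cycleSuc-suc (trans (suc[m∸1+n]≡m∸n (toℕ<n i)) (cong (ℓ ∸_) i≡0))
                  (<-trans (plus-block< i) (ℓ<lastBlock ℓ)))
    refl a≡top
  arcKind {ℓ} (e2 i _ i≡0 b≡0) = link
    (cycleSuc-suc (cong suc (sym (trans (cong (ℓ +_) i≡0) (+-identityʳ ℓ)))) (ℓ<lastBlock ℓ))
    b≡0 refl
  arcKind {ℓ} (e3 i _ i≡last a≡top) = link
    (cycleSuc-suc (cong suc (trans (sym (+-suc ℓ (toℕ i))) (cong (ℓ +_) (last-index i i≡last))))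
                  (minus-block< i))
    refl a≡top
  arcKind {ℓ} (e4 i _ i≡last b≡0) = link
    (trans (cong (ℓ ∸_) (last-index i i≡last)) (trans (n∸n≡0 ℓ) (sym (cycleSuc-last _))))
    b≡0 refl
  arcKind {ℓ} (cp i i' _ _ i'≡1+i a≡top b≡0) = link
    (cycleSuc-suc (trans (suc[m∸1+n]≡m∸n (toℕ<n i')) (cong (λ c → ℓ ∸ c) i'≡1+i))
              (<-trans (plus-block< i') (ℓ<lastBlock ℓ)))
    b≡0 a≡top
  arcKind {ℓ} (cm i i' _ _ i'≡1+i a≡top b≡0) = link
    (cycleSuc-suc (cong suc (trans (sym (+-suc ℓ (toℕ i))) (cong (ℓ +_) (sym i'≡1+i))))
                  (minus-block< i))
    b≡0 a≡top
  arcKind (fm i j a b f≡neg a≡1+j b≡) =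
    cross (plus-block≢minus-block i i) (cong (minus i) b≡opp)
          (subst InteriorLevel (sym a≡1+j) (interior-suc j))
          (subst (λ c → InteriorLevel (toℕ c)) (sym b≡opp) (interior-opposite a j a≡1+j))
          (downward i j a b f≡neg a≡1+j)
    where
    b≡opp = cross-partner a b j a≡1+j b≡
  arcKind (fp i j a b f≡pos a≡1+j b≡) =
    cross (≢-sym (plus-block≢minus-block i i))
          (cong (plus i) (trans (sym (opposite-involutive a)) (cong opposite (sym b≡opp))))
          (subst (λ c → InteriorLevel (toℕ c)) (sym b≡opp) (interior-opposite a j a≡1+j))
          (subst InteriorLevel (sym a≡1+j) (interior-suc j))
          (upward i j a b f≡pos a≡1+j)
    where
    b≡opp = cross-partner a b j a≡1+j b≡

  module _ {ℓ} {f : SignMap d ℓ} where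

    private
      _⟶_ : SV d ℓ → SV d ℓ → Set
      _⟶_ = SArc d ℓ f

    top-not-interior : ∀ {x : SV d ℓ} → level x ≡ height x → ¬ InteriorLevel (level x)
    top-not-interior {x} top (_ , below-top) =
      <⇒≱ below-top (subst (suc (suc n) ≤_) (sym top) (2+n≤height x))

    bottom-not-interior : ∀ {p} → p ≡ 0 → ¬ InteriorLevel p
    bottom-not-interior refl (() , _)

    bottom-not-top : ∀ {x : SV d ℓ} → level x ≡ 0 → level x ≢ height x
    bottom-not-top {x} bottom top with subst (suc (suc n) ≤_) (trans (sym top) bottom) (2+n≤height x)
    ... | ()

    no-loop : ∀ {x} → ¬ (x ⟶ x)
    no-loop x⟶x with arcKind x⟶x
    ... | inBlock _ x<x = <-irrefl refl x<x
    ... | link x≡next _ _ = cycleSuc-≢ _ (sym x≡next)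
    ... | cross x≢x _ _ _ _ = x≢x refl

    level-increases : ∀ {x y} → x ⟶ y → block x ≡ block y → level x < level y
    level-increases x⟶y same with arcKind x⟶y
    ... | inBlock _ x<y = x<y
    ... | link y≡next _ _ = ⊥-elim (cycleSuc-≢ _ (trans (sym y≡next) (sym same)))
    ... | cross different _ _ _ _ = ⊥-elim (different same)

    -- Opposite cross arcs between the same mates would need both f i j ≡ neg and f i j ≡ pos.
    no-2-cycle : ∀ {x y} → x ⟶ y → ¬ (y ⟶ x)
    no-2-cycle x⟶y y⟶x with arcKind x⟶y | arcKind y⟶x
    ... | inBlock _ x<y | inBlock _ y<x = <-asym x<y y<x
    ... | inBlock same _ | link x≡next _ _ = cycleSuc-≢ _ (trans (sym x≡next) same)
    ... | inBlock same _ | cross different _ _ _ _ = different (sym same)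
    ... | link y≡next _ _ | inBlock same _ = cycleSuc-≢ _ (trans (sym y≡next) same)
    ... | link _ y≡0 _ | link _ _ y≡top = bottom-not-top y≡0 y≡top
    ... | link _ y≡0 _ | cross _ _ y-int _ _ = bottom-not-interior y≡0 y-int
    ... | cross different _ _ _ _ | inBlock same _ = different (sym same)
    ... | cross _ _ x-int _ _ | link _ x≡0 _ = bottom-not-interior x≡0 x-int
    ... | cross _ _ _ _ s | cross _ _ _ _ s' = opposite-signs s s'
      where
      opposite-signs : ∀ {x y : SV d ℓ} → CrossSign f x y → ¬ CrossSign f y x
      opposite-signs (downward i j a b f≡neg a≡) (upward _ j' _ _ f≡pos a≡')
        with toℕ-injective (suc-injective (trans (sym a≡) a≡'))
      ... | refl with trans (sym f≡neg) f≡pos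
      ... | ()
      opposite-signs (upward i j a b f≡pos a≡) (downward _ j' _ _ f≡neg a≡')
        with toℕ-injective (suc-injective (trans (sym a≡) a≡'))
      ... | refl with trans (sym f≡pos) f≡neg
      ... | ()

    top-out : ∀ {x z} → x ⟶ z → level x ≡ height x →
              block z ≡ cycleSuc (lastBlock ℓ) (block x) × level z ≡ 0
    top-out {x} {z} x⟶z x≡top with arcKind x⟶z
    ... | link z≡next z≡0 _ = z≡next , z≡0
    ... | cross _ _ x-int _ _ = ⊥-elim (top-not-interior x≡top x-int)
    ... | inBlock same x<z =
          ⊥-elim (<⇒≱ x<z (≤-trans (level≤height z)
                                   (≤-reflexive (trans (height-block (sym same)) (sym x≡top)))))

    triangle-block₁₂ : ∀ {x y z} → x ⟶ y → y ⟶ z → x ⟶ z → block x ≡ block y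
    triangle-block₁₂ x⟶y y⟶z x⟶z with arcKind x⟶y
    ... | inBlock same _ = same
    ... | link y≡next y≡0 x≡top with top-out x⟶z x≡top | arcKind y⟶z
    ...   | _ , z≡0 | inBlock _ y<z = ⊥-elim (<-irrefl (trans y≡0 (sym z≡0)) y<z)
    ...   | z≡next , _ | link z≡next' _ _ =
            ⊥-elim (cycleSuc-≢ _ (trans (sym z≡next') (trans z≡next (sym y≡next))))
    ...   | z≡next , _ | cross y≢z _ _ _ _ = ⊥-elim (y≢z (trans y≡next (sym z≡next)))
    triangle-block₁₂ {x} x⟶y y⟶z x⟶z | cross _ y≡mate x-int y-int _ with arcKind y⟶z
    ... | link _ _ y≡top = ⊥-elim (top-not-interior y≡top y-int)
    ... | cross _ z≡mate _ _ _ =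
          ⊥-elim (no-loop (subst (x ⟶_) (mate-mate y≡mate z≡mate) x⟶z))
    ... | inBlock y~z y<z with arcKind x⟶z
    ...   | inBlock x~z _ = trans x~z (sym y~z)
    ...   | link _ _ x≡top = ⊥-elim (top-not-interior x≡top x-int)
    ...   | cross _ z≡mate _ _ _ = ⊥-elim (<-irrefl (cong level (trans y≡mate (sym z≡mate))) y<z)

    triangle-block₂₃ : ∀ {x y z} → x ⟶ y → y ⟶ z → x ⟶ z → block y ≡ block z
    triangle-block₂₃ x⟶y y⟶z x⟶z with arcKind y⟶z
    ... | inBlock same _ = same
    ... | link z≡next z≡0 y≡top with arcKind x⟶z
    ...   | inBlock _ x<z = ⊥-elim (n≮0 (subst (_ <_) z≡0 x<z))
    ...   | cross _ _ _ z-int _ = ⊥-elim (bottom-not-interior z≡0 z-int)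
    ...   | link z≡next' _ x≡top = trans (proj₁ (top-out x⟶y x≡top)) (sym z≡next')
    triangle-block₂₃ {x} {y} x⟶y y⟶z x⟶z | cross _ z≡mate y-int z-int _ with arcKind x⟶y
    ... | link _ y≡0 _ = ⊥-elim (bottom-not-interior y≡0 y-int)
    ... | cross _ y≡mate _ _ _ =
          ⊥-elim (no-2-cycle x⟶y (subst (y ⟶_) (mate-mate y≡mate z≡mate) y⟶z))
    ... | inBlock x~y _ with arcKind x⟶z
    ...   | inBlock x~z _ = trans (sym x~y) x~z
    ...   | link _ z≡0 _ = ⊥-elim (bottom-not-interior z≡0 z-int)
    ...   | cross _ z≡mate' _ _ _ =
            ⊥-elim (no-loop (subst (x ⟶_) (sym (mate-injective (trans (sym z≡mate') z≡mate))) x⟶y))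

    -- The gadget blocks lack exactly the arc from s to t.
    no-gadget-span : ∀ {x y} → x ⟶ y → level x ≡ 0 → level y ≢ d
    no-gadget-span (tp _ _ b _) _ = <⇒≢ (toℕ<n b)
    no-gadget-span (tm _ _ b _) _ = <⇒≢ (toℕ<n b)
    no-gadget-span (tL _ b _) _ = <⇒≢ (toℕ<n b) ∘ suc-injective
    no-gadget-span (tR _ b _) _ = <⇒≢ (toℕ<n b) ∘ suc-injective
    no-gadget-span (sL u) _ = <⇒≢ (toℕ<n u) ∘ suc-injective
    no-gadget-span (sR u) _ = <⇒≢ (toℕ<n u) ∘ suc-injective
    no-gadget-span (Lt _) ()
    no-gadget-span (Rt _) ()
    no-gadget-span (e1 _ _ _ _) _ ()
    no-gadget-span (e3 _ _ _ _) _ ()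
    no-gadget-span (e2 _ b _ _) _ = <⇒≢ (toℕ<n b)
    no-gadget-span (e4 _ b _ _) _ = <⇒≢ (toℕ<n b)
    no-gadget-span (cp _ _ _ b _ _ _) _ = <⇒≢ (toℕ<n b)
    no-gadget-span (cm _ _ _ b _ _ _) _ = <⇒≢ (toℕ<n b)
    no-gadget-span (fm _ _ _ b _ _ _) _ = <⇒≢ (toℕ<n b)
    no-gadget-span (fp _ _ a _ _ _ _) _ = <⇒≢ (toℕ<n a)

  gadgetVertex : ∀ {ℓ} → SV d ℓ → SV d ℓ → (Fin (suc (suc n)) → SV d ℓ) → ℕ → SV d ℓ
  gadgetVertex s t g zero = s
  gadgetVertex s t g (suc p) with p ≟ suc (suc n)
  ... | yes _ = t
  ... | no _ = g (clamp (suc n) p)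

  module _ {ℓ} {s t : SV d ℓ} {g : Fin (suc (suc n)) → SV d ℓ} where

    gadgetVertex-top : gadgetVertex s t g d ≡ t
    gadgetVertex-top with suc (suc n) ≟ suc (suc n)
    ... | yes _ = refl
    ... | no ≢ = ⊥-elim (≢ refl)

    gadgetVertex-middle : ∀ {p} → p < suc (suc n) → gadgetVertex s t g (suc p) ≡ g (clamp (suc n) p)
    gadgetVertex-middle {p} p< with p ≟ suc (suc n)
    ... | yes refl = ⊥-elim (<-irrefl refl p<)
    ... | no _ = refl

    gadgetVertex-arc : ∀ {f : SignMap d ℓ} →
      (∀ u → SArc d ℓ f s (g u)) → (∀ u → SArc d ℓ f (g u) t) →
      (∀ u v → toℕ u < toℕ v → SArc d ℓ f (g u) (g v)) →
      ∀ {p q} → p < q → q ≤ d → ¬ (p ≡ 0 × q ≡ d) →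
      SArc d ℓ f (gadgetVertex s t g p) (gadgetVertex s t g q)
    gadgetVertex-arc s⟶g g⟶t g⟶g {zero} {suc q} _ q≤d not-span with m≤n⇒m<n∨m≡n (s≤s⁻¹ q≤d)
    ... | inj₁ q< = subst (SArc _ _ _ s) (sym (gadgetVertex-middle q<)) (s⟶g _)
    ... | inj₂ refl = ⊥-elim (not-span (refl , refl))
    gadgetVertex-arc s⟶g g⟶t g⟶g {suc p} {suc q} p<q q≤d _ with m≤n⇒m<n∨m≡n (s≤s⁻¹ q≤d)
    ... | inj₁ q< = subst₂ (SArc _ _ _) (sym (gadgetVertex-middle (<-trans (s≤s⁻¹ p<q) q<)))
                      (sym (gadgetVertex-middle q<)) (g⟶g _ _ (clamp-mono (s≤s⁻¹ p<q) (s≤s⁻¹ q<)))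
    ... | inj₂ refl = subst₂ (SArc _ _ _) (sym (gadgetVertex-middle (s≤s⁻¹ p<q)))
                        (sym gadgetVertex-top) (g⟶t _)

  -- Inverse of (block, level); arguments out of range give clamped junk values.
  vertexAt : (L : ℕ) → ℕ → ℕ → SV d (suc L)
  vertexAt L k p with k ≤? L
  ... | yes _ = plus (clamp L (L ∸ k)) (clamp (suc (suc n)) p)
  ... | no _ with k ≟ suc L
  ...   | yes _ = gadgetVertex sl tl lft p
  ...   | no _ with k ≤? suc L + suc L
  ...     | yes _ = minus (clamp L (k ∸ suc (suc L))) (clamp (suc (suc n)) p)
  ...     | no _ = gadgetVertex sr tr rgt p

  module _ {L : ℕ} where

    vertexAt-plus : ∀ {k p} → k ≤ L → vertexAt L k p ≡ plus (clamp L (L ∸ k)) (clamp (suc (suc n)) p)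
    vertexAt-plus {k} k≤L with k ≤? L
    ... | yes _ = refl
    ... | no k≰L = ⊥-elim (k≰L k≤L)

    vertexAt-left : ∀ {p} → vertexAt L (suc L) p ≡ gadgetVertex sl tl lft p
    vertexAt-left with suc L ≤? L
    ... | yes 1+L≤L = ⊥-elim (1+n≰n 1+L≤L)
    ... | no _ with suc L ≟ suc L
    ...   | yes _ = refl
    ...   | no ≢ = ⊥-elim (≢ refl)

    vertexAt-minus : ∀ {k p} → suc L < k → k ≤ suc L + suc L →
                     vertexAt L k p ≡ minus (clamp L (k ∸ suc (suc L))) (clamp (suc (suc n)) p)
    vertexAt-minus {k} 1+L<k k≤ with k ≤? L
    ... | yes k≤L = ⊥-elim (<⇒≱ 1+L<k (≤-trans k≤L (n≤1+n L)))
    ... | no _ with k ≟ suc L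
    ...   | yes refl = ⊥-elim (<-irrefl refl 1+L<k)
    ...   | no _ with k ≤? suc L + suc L
    ...     | yes _ = refl
    ...     | no k≰ = ⊥-elim (k≰ k≤)

    vertexAt-right : ∀ {p} → vertexAt L (lastBlock (suc L)) p ≡ gadgetVertex sr tr rgt p
    vertexAt-right with lastBlock (suc L) ≤? L
    ... | yes last≤L = ⊥-elim (<⇒≱ (<-trans (n<1+n L) (ℓ<lastBlock (suc L))) last≤L)
    ... | no _ with lastBlock (suc L) ≟ suc L
    ...   | yes last≡ = ⊥-elim (<⇒≢ (ℓ<lastBlock (suc L)) (sym last≡))
    ...   | no _ with lastBlock (suc L) ≤? suc L + suc L
    ...     | yes last≤ = ⊥-elim (1+n≰n last≤)
    ...     | no _ = refl

    vertexAt-coordinates : (x : SV d (suc L)) → vertexAt L (block x) (level x) ≡ x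
    vertexAt-coordinates (plus i a) = trans (vertexAt-plus (m∸n≤m L (toℕ i)))
      (cong₂ plus (trans (cong (clamp L) (m∸[m∸n]≡n (s≤s⁻¹ (toℕ<n i)))) (clamp-toℕ i)) (clamp-toℕ a))
    vertexAt-coordinates (minus i a) =
      trans (vertexAt-minus (s≤s (s≤s (m≤m+n L (toℕ i)))) (s≤s⁻¹ (minus-block< i)))
        (cong₂ minus (trans (cong (clamp L) (m+n∸m≡n L (toℕ i))) (clamp-toℕ i)) (clamp-toℕ a))
    vertexAt-coordinates (lft u) =
      trans vertexAt-left (trans (gadgetVertex-middle {s = sl} {tl} (toℕ<n u)) (cong lft (clamp-toℕ u)))
    vertexAt-coordinates sl = vertexAt-left
    vertexAt-coordinates tl = trans vertexAt-left (gadgetVertex-top {s = sl} {g = lft})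
    vertexAt-coordinates (rgt u) =
      trans vertexAt-right (trans (gadgetVertex-middle {s = sr} {tr} (toℕ<n u)) (cong rgt (clamp-toℕ u)))
    vertexAt-coordinates sr = vertexAt-right
    vertexAt-coordinates tr = trans vertexAt-right (gadgetVertex-top {s = sr} {g = rgt})

    coordinates-injective : ∀ {x y : SV d (suc L)} → block x ≡ block y → level x ≡ level y → x ≡ y
    coordinates-injective {x} {y} same-block same-level = begin
      x                                  ≡⟨ sym (vertexAt-coordinates x) ⟩
      vertexAt L (block x) (level x)     ≡⟨ cong₂ (vertexAt L) same-block same-level ⟩
      vertexAt L (block y) (level y)     ≡⟨ vertexAt-coordinates y ⟩
      y                                  ∎
      where open ≡-Reasoning

    data BlockKind (k : ℕ) : Set where
      plusBlock  : k ≤ L → BlockKind k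
      leftBlock  : k ≡ suc L → BlockKind k
      minusBlock : suc L < k → k ≤ suc L + suc L → BlockKind k
      rightBlock : k ≡ lastBlock (suc L) → BlockKind k

    blockKind : ∀ k → k ≤ lastBlock (suc L) → BlockKind k
    blockKind k k≤ with k ≤? L
    ... | yes k≤L = plusBlock k≤L
    ... | no k≰L with k ≟ suc L
    ...   | yes k≡ = leftBlock k≡
    ...   | no k≢ with k ≤? suc L + suc L
    ...     | yes k≤' = minusBlock (≤∧≢⇒< (≰⇒> k≰L) (≢-sym k≢)) k≤'
    ...     | no k≰' = rightBlock (≤-antisym k≤ (≰⇒> k≰'))

    plusBlock-height : ∀ {k} → k ≤ L → blockHeight (suc L) k ≡ suc (suc n)
    plusBlock-height k≤L =
      blockHeight-tournament [ <⇒≢ (s≤s k≤L) , <⇒≢ (<-trans (s≤s k≤L) (ℓ<lastBlock (suc L))) ]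

    minusBlock-height : ∀ {k} → suc L < k → k ≤ suc L + suc L → blockHeight (suc L) k ≡ suc (suc n)
    minusBlock-height 1+L<k k≤ = blockHeight-tournament [ (λ k≡ → <⇒≢ 1+L<k (sym k≡)) , <⇒≢ (s≤s k≤) ]

    minus-offset≤ : ∀ {k} → k ≤ suc L + suc L → k ∸ suc (suc L) ≤ L
    minus-offset≤ k≤ = ≤-trans (∸-monoˡ-≤ (suc (suc L)) k≤) (≤-reflexive (m+n∸n≡m L (suc L)))

    vertexAt-plus-top : ∀ {k} → k ≤ L →
      vertexAt L k (blockHeight (suc L) k) ≡ plus (clamp L (L ∸ k)) (clamp (suc (suc n)) (suc (suc n)))
    vertexAt-plus-top k≤L = trans (vertexAt-plus k≤L) (cong (plus _ ∘ clamp _) (plusBlock-height k≤L))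

    vertexAt-minus-top : ∀ {k} → (1+L<k : suc L < k) (k≤ : k ≤ suc L + suc L) →
      vertexAt L k (blockHeight (suc L) k) ≡ minus (clamp L (k ∸ suc (suc L))) (clamp (suc (suc n)) (suc (suc n)))
    vertexAt-minus-top 1+L<k k≤ =
      trans (vertexAt-minus 1+L<k k≤) (cong (minus _ ∘ clamp _) (minusBlock-height 1+L<k k≤))

    vertexAt-left-top : vertexAt L (suc L) (blockHeight (suc L) (suc L)) ≡ tl
    vertexAt-left-top = trans vertexAt-left
      (trans (cong (gadgetVertex sl tl lft) (blockHeight-left (suc L))) (gadgetVertex-top {s = sl} {g = lft}))

    vertexAt-right-top : vertexAt L (lastBlock (suc L)) (blockHeight (suc L) (lastBlock (suc L))) ≡ tr
    vertexAt-right-top = trans vertexAt-right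
      (trans (cong (gadgetVertex sr tr rgt) (blockHeight-right (suc L))) (gadgetVertex-top {s = sr} {g = rgt}))

    top-index : toℕ (clamp (suc (suc n)) (suc (suc n))) ≡ d ∸ 1
    top-index = toℕ-clamp ≤-refl

    module _ {f : SignMap d (suc L)} where

      private
        _⟶_ : SV d (suc L) → SV d (suc L) → Set
        _⟶_ = SArc d (suc L) f

      blockArc : ∀ {k p q} → k ≤ lastBlock (suc L) → p < q → q ≤ blockHeight (suc L) k →
                 ¬ (p ≡ 0 × q ≡ d) → vertexAt L k p ⟶ vertexAt L k q
      blockArc {k} k≤ p<q q≤ not-span with blockKind k k≤
      ... | plusBlock k≤L = subst₂ _⟶_ (sym (vertexAt-plus k≤L)) (sym (vertexAt-plus k≤L))
              (tp _ _ _ (clamp-mono p<q (subst (_ ≤_) (plusBlock-height k≤L) q≤)))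
      ... | minusBlock 1+L<k k≤' = subst₂ _⟶_ (sym (vertexAt-minus 1+L<k k≤')) (sym (vertexAt-minus 1+L<k k≤'))
              (tm _ _ _ (clamp-mono p<q (subst (_ ≤_) (minusBlock-height 1+L<k k≤') q≤)))
      ... | leftBlock refl = subst₂ _⟶_ (sym vertexAt-left) (sym vertexAt-left)
              (gadgetVertex-arc sL Lt tL p<q (subst (_ ≤_) (blockHeight-left (suc L)) q≤) not-span)
      ... | rightBlock refl = subst₂ _⟶_ (sym vertexAt-right) (sym vertexAt-right)
              (gadgetVertex-arc sR Rt tR p<q (subst (_ ≤_) (blockHeight-right (suc L)) q≤) not-span)

      linkArc : ∀ {k} → k < lastBlock (suc L) → vertexAt L k (blockHeight (suc L) k) ⟶ vertexAt L (suc k) 0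
      linkArc {k} k< with blockKind k (<⇒≤ k<)
      ... | plusBlock k≤L with m≤n⇒m<n∨m≡n k≤L
      ...   | inj₁ k<L = subst₂ _⟶_ (sym (vertexAt-plus-top k≤L)) (sym (vertexAt-plus k<L))
                (cp _ _ _ _ index-step top-index refl)
        where
        index-step : toℕ (clamp L (L ∸ k)) ≡ suc (toℕ (clamp L (L ∸ suc k)))
        index-step = trans (toℕ-clamp (m∸n≤m L k))
          (trans (sym (suc[m∸1+n]≡m∸n k<L)) (cong suc (sym (toℕ-clamp (m∸n≤m L (suc k))))))
      ...   | inj₂ refl = subst₂ _⟶_ (sym (vertexAt-plus-top k≤L)) (sym vertexAt-left)
                (e1 _ _ (trans (toℕ-clamp (m∸n≤m L L)) (n∸n≡0 L)) top-index)
      linkArc {k} k< | leftBlock refl =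
        subst₂ _⟶_ (sym vertexAt-left-top) (sym (vertexAt-minus (n<1+n (suc L)) (s≤s (m≤n+m (suc L) L))))
          (e2 _ _ (trans (cong (toℕ ∘ clamp L) (n∸n≡0 L)) (toℕ-clamp z≤n)) refl)
      linkArc {k} k< | minusBlock 1+L<k k≤ with m≤n⇒m<n∨m≡n k≤
      ... | inj₁ k<' = subst₂ _⟶_ (sym (vertexAt-minus-top 1+L<k k≤))
              (sym (vertexAt-minus (<-trans 1+L<k (n<1+n k)) k<')) (cm _ _ _ _ index-step top-index refl)
        where
        index-step : toℕ (clamp L (suc k ∸ suc (suc L))) ≡ suc (toℕ (clamp L (k ∸ suc (suc L))))
        index-step = trans (toℕ-clamp (minus-offset≤ k<'))
          (trans (+-∸-assoc 1 1+L<k) (cong suc (sym (toℕ-clamp (minus-offset≤ k≤)))))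
      ... | inj₂ refl = subst₂ _⟶_ (sym (vertexAt-minus-top 1+L<k k≤)) (sym vertexAt-right)
              (e3 _ _ (trans (toℕ-clamp (minus-offset≤ k≤)) (m+n∸n≡m L (suc L))) top-index)
      linkArc {k} k< | rightBlock refl = ⊥-elim (<-irrefl refl k<)

      wrapArc : vertexAt L (lastBlock (suc L)) (blockHeight (suc L) (lastBlock (suc L))) ⟶ vertexAt L 0 0
      wrapArc = subst₂ _⟶_ (sym vertexAt-right-top) (sym (vertexAt-plus {p = 0} z≤n))
                         (e4 _ _ (toℕ-clamp ≤-refl) refl)

  module HomImage {L L' : ℕ} {f : SignMap d (suc L)} {f' : SignMap d (suc L')}
                  (h : Hom (S d (suc L) f) (S d (suc L') f')) where

    private
      φ : SV d (suc L) → SV d (suc L')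
      φ = proj₁ h
      φ-arc : ∀ {x y} → SArc d (suc L) f x y → SArc d (suc L') f' (φ x) (φ y)
      φ-arc = proj₂ h
      N : ℕ
      N = lastBlock (suc L)
      v : ℕ → ℕ → SV d (suc L)
      v = vertexAt L
      top : ℕ → ℕ
      top = blockHeight (suc L)

    imageBlock : ℕ → ℕ
    imageBlock k = block (φ (v k 0))

    2≤top : ∀ k → 2 ≤ top k
    2≤top k = ≤-trans (s≤s (s≤s z≤n)) (2+n≤blockHeight (suc L) k)

    shortArc : ∀ {k p q} → k ≤ N → p < q → q ≤ suc (suc p) → q ≤ top k → SArc d (suc L) f (v k p) (v k q)
    shortArc {k} {p} {q} k≤ p<q q≤2+p q≤top = blockArc k≤ p<q q≤top not-span
      where
      not-span : ¬ (p ≡ 0 × q ≡ d)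
      not-span (refl , refl) = <⇒≱ (s≤s (s≤s (s≤s z≤n))) q≤2+p

    -- Consecutive levels of a block lie on a transitive triangle inside the block.
    consecutive-same-block : ∀ {k p} → k ≤ N → suc p ≤ top k → block (φ (v k p)) ≡ block (φ (v k (suc p)))
    consecutive-same-block {k} {p} k≤ 1+p≤ with suc (suc p) ≤? top k
    ... | yes 2+p≤ = triangle-block₁₂ (φ-arc (shortArc k≤ (n<1+n p) (n≤1+n _) 1+p≤))
                       (φ-arc (shortArc k≤ (n<1+n (suc p)) (n≤1+n _) 2+p≤))
                       (φ-arc (shortArc k≤ (m<n⇒m<1+n (n<1+n p)) ≤-refl 2+p≤))
    consecutive-same-block {k} {zero} k≤ _ | no 2≰top = ⊥-elim (2≰top (2≤top k))
    consecutive-same-block {k} {suc p} k≤ 2+p≤ | no _ =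
      triangle-block₂₃ (φ-arc (shortArc k≤ (n<1+n p) (n≤1+n _) (<⇒≤ 2+p≤)))
                       (φ-arc (shortArc k≤ (n<1+n (suc p)) (n≤1+n _) 2+p≤))
                       (φ-arc (shortArc k≤ (m<n⇒m<1+n (n<1+n p)) ≤-refl 2+p≤))

    image-block-constant : ∀ {k p} → k ≤ N → p ≤ top k → block (φ (v k p)) ≡ imageBlock k
    image-block-constant {p = zero} _ _ = refl
    image-block-constant {p = suc p} k≤ 1+p≤ =
      trans (sym (consecutive-same-block k≤ 1+p≤)) (image-block-constant k≤ (<⇒≤ 1+p≤))

    image-level-gap : ∀ {k} p r → k ≤ N → p + r ≤ top k → level (φ (v k p)) + r ≤ level (φ (v k (p + r)))
    image-level-gap {k} p zero _ _ =
      ≤-reflexive (trans (+-identityʳ _) (cong (level ∘ φ ∘ v k) (sym (+-identityʳ p))))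
    image-level-gap {k} p (suc r) k≤ p+1+r≤ = begin
      level (φ (v k p)) + suc r        ≡⟨ +-suc _ r ⟩
      suc (level (φ (v k p)) + r)      ≤⟨ s≤s (image-level-gap p r k≤ (<⇒≤ 1+p+r≤)) ⟩
      suc (level (φ (v k (p + r))))    ≤⟨ level-increases (φ-arc (shortArc k≤ (n<1+n _) (n≤1+n _) 1+p+r≤))
                                                          (consecutive-same-block k≤ 1+p+r≤) ⟩
      level (φ (v k (suc (p + r))))    ≡⟨ cong (level ∘ φ ∘ v k) (sym (+-suc p r)) ⟩
      level (φ (v k (p + suc r)))      ∎
      where
      open ≤-Reasoning
      1+p+r≤ : suc (p + r) ≤ top k
      1+p+r≤ = subst (_≤ top k) (+-suc p r) p+1+r≤

    top≤image-level : ∀ {k} → k ≤ N → top k ≤ level (φ (v k (top k)))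
    top≤image-level {k} k≤ = m+n≤o⇒n≤o _ (image-level-gap 0 (top k) k≤ ≤-refl)

    image-bottom≤1 : ∀ {k} → k ≤ N → level (φ (v k 0)) ≤ 1
    image-bottom≤1 {k} k≤ = +-cancelʳ-≤ (suc (suc n)) _ 1 (begin
      level (φ (v k 0)) + suc (suc n)   ≤⟨ +-monoʳ-≤ _ (2+n≤blockHeight (suc L) k) ⟩
      level (φ (v k 0)) + top k         ≤⟨ image-level-gap 0 (top k) k≤ ≤-refl ⟩
      level (φ (v k (top k)))           ≤⟨ level≤height _ ⟩
      height (φ (v k (top k)))          ≤⟨ height≤d _ ⟩
      d                                 ∎)
      where open ≤-Reasoning

    -- The top of an image block has level at least 2 and the bottom at most 1, so a
    -- link arc can only be mapped to a link arc.
    link-image : ∀ {k k'} → k ≤ N → k' ≤ N → SArc d (suc L) f (v k (top k)) (v k' 0) →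
      block (φ (v k' 0)) ≡ cycleSuc (lastBlock (suc L')) (block (φ (v k (top k)))) ×
      level (φ (v k' 0)) ≡ 0 × level (φ (v k (top k))) ≡ height (φ (v k (top k)))
    link-image {k} {k'} k≤ k'≤ arc with arcKind (φ-arc arc)
    ... | link block≡ bottom top≡ = block≡ , bottom , top≡
    ... | cross _ _ (_ , below-top) _ _ =
          ⊥-elim (<⇒≱ below-top (≤-trans (2+n≤blockHeight (suc L) k) (top≤image-level k≤)))
    ... | inBlock _ up = ⊥-elim (<⇒≱ (<-≤-trans up (image-bottom≤1 k'≤))
                                     (≤-trans (n≤1+n 1) (≤-trans (2≤top k) (top≤image-level k≤))))

    image-bottom : ∀ {k} → k ≤ N → level (φ (v k 0)) ≡ 0
    image-bottom {zero} _ = proj₁ (proj₂ (link-image ≤-refl z≤n wrapArc))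
    image-bottom {suc k} 1+k≤ = proj₁ (proj₂ (link-image (<⇒≤ 1+k≤) 1+k≤ (linkArc 1+k≤)))

    image-top : ∀ {k} → k ≤ N → level (φ (v k (top k))) ≡ height (φ (v k (top k)))
    image-top {k} k≤ with m≤n⇒m<n∨m≡n k≤
    ... | inj₁ k< = proj₂ (proj₂ (link-image k≤ k< (linkArc k<)))
    ... | inj₂ refl = proj₂ (proj₂ (link-image ≤-refl z≤n wrapArc))

    imageBlock-suc : ∀ k → k < N → imageBlock (suc k) ≡ cycleSuc (lastBlock (suc L')) (imageBlock k)
    imageBlock-suc k k< = trans (proj₁ (link-image (<⇒≤ k<) k< (linkArc k<)))
                                (cong (cycleSuc _) (image-block-constant (<⇒≤ k<) ≤-refl))

    imageBlock-wrap : imageBlock 0 ≡ cycleSuc (lastBlock (suc L')) (imageBlock N)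
    imageBlock-wrap = trans (proj₁ (link-image ≤-refl z≤n wrapArc))
                            (cong (cycleSuc _) (image-block-constant ≤-refl ≤-refl))

    -- A tournament block cannot be mapped onto a gadget: its arc from bottom to top would
    -- become the missing arc s → t.
    top≡image-height : ∀ {k} → k ≤ N → top k ≡ height (φ (v k (top k)))
    top≡image-height {k} k≤ = ≤-antisym (≤-trans (top≤image-level k≤) (level≤height T)) height≤top
      where
      T : SV d (suc L')
      T = φ (v k (top k))
      height≤top : height T ≤ top k
      height≤top with top k ≟ d
      ... | yes top≡d = subst (height T ≤_) (sym top≡d) (height≤d T)
      ... | no top≢d = ≤-trans (s≤s⁻¹ (≤∧≢⇒< (height≤d T) height≢d)) (2+n≤blockHeight (suc L) k)
        where
        height≢d : height T ≢ d
        height≢d = no-gadget-span (φ-arc (blockArc k≤ (≤-trans (s≤s z≤n) (2≤top k)) ≤-refl (top≢d ∘ proj₂)))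
                                  (image-bottom k≤) ∘ trans (image-top k≤)

    image-blockHeight : ∀ {k} → k ≤ N → top k ≡ blockHeight (suc L') (imageBlock k)
    image-blockHeight {k} k≤ = trans (top≡image-height k≤)
      (trans (height≡blockHeight (φ (v k (top k)))) (cong (blockHeight _) (image-block-constant k≤ ≤-refl)))

    image-gadget⇒gadget : ∀ k → k ≤ N → GadgetBlock (suc L) k → GadgetBlock (suc L') (imageBlock k)
    image-gadget⇒gadget k k≤ gadget =
      blockHeight≡d⇒gadget (trans (sym (image-blockHeight k≤)) (blockHeight-gadget gadget))

    image-gadget⇐gadget : ∀ k → k ≤ N → GadgetBlock (suc L') (imageBlock k) → GadgetBlock (suc L) k
    image-gadget⇐gadget k k≤ gadget =
      blockHeight≡d⇒gadget (trans (image-blockHeight k≤) (blockHeight-gadget gadget))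

    image-block : ∀ x → block (φ x) ≡ imageBlock (block x)
    image-block x = trans (cong (block ∘ φ) (sym (vertexAt-coordinates x)))
                          (image-block-constant (block≤lastBlock x) (level≤blockHeight x))

    image-level : ∀ x → level (φ x) ≡ level x
    image-level x = ≤-antisym upper lower
      where
      k = block x
      p = level x
      k≤ : k ≤ N
      k≤ = block≤lastBlock x
      φx≡ : φ (v k p) ≡ φ x
      φx≡ = cong φ (vertexAt-coordinates x)
      p+[top∸p] : p + (top k ∸ p) ≡ top k
      p+[top∸p] = m+[n∸m]≡n (level≤blockHeight x)
      lower : p ≤ level (φ x)
      lower = subst (λ y → p ≤ level y) φx≡ (m+n≤o⇒n≤o _ (image-level-gap 0 p k≤ (level≤blockHeight x)))
      upper : level (φ x) ≤ p
      upper = +-cancelʳ-≤ (top k ∸ p) (level (φ x)) p (begin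
        level (φ x) + (top k ∸ p)              ≡⟨ cong (λ y → level y + (top k ∸ p)) (sym φx≡) ⟩
        level (φ (v k p)) + (top k ∸ p)        ≤⟨ image-level-gap p (top k ∸ p) k≤ (≤-reflexive p+[top∸p]) ⟩
        level (φ (v k (p + (top k ∸ p))))      ≡⟨ cong (level ∘ φ ∘ v k) p+[top∸p] ⟩
        level (φ (v k (top k)))                ≡⟨ trans (image-top k≤) (sym (top≡image-height k≤)) ⟩
        top k                                  ≡⟨ sym p+[top∸p] ⟩
        p + (top k ∸ p)                        ∎)
        where open ≤-Reasoning

  module _ {L L' : ℕ} {f : SignMap d (suc L)} {f' : SignMap d (suc L')}
           (h : Hom (S d (suc L) f) (S d (suc L') f')) where
    open HomImage h
    open CyclicMap imageBlock imageBlock-suc imageBlock-wrap image-gadget⇒gadget image-gadget⇐gadget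

    hom-length : suc L ≡ suc L'
    hom-length = a≡b

    hom-block : (∀ x → block (proj₁ h x) ≡ block x) ⊎ (∀ x → block (proj₁ h x) ≡ halfTurn (suc L) (block x))
    hom-block = Sum.map (λ C≡k x → trans (image-block x) (C≡k _ (block≤lastBlock x)))
                        (λ C≡halfTurn x → trans (image-block x) (C≡halfTurn _ (block≤lastBlock x)))
                        (identity-or-halfTurn a≡b)

  rotate : ∀ {ℓ} → SV d ℓ → SV d ℓ
  rotate (plus i a) = minus (opposite i) a
  rotate (minus i a) = plus (opposite i) a
  rotate (lft u) = rgt u
  rotate (rgt u) = lft u
  rotate sl = sr
  rotate sr = sl
  rotate tl = tr
  rotate tr = tl

  level-rotate : ∀ {ℓ} (x : SV d ℓ) → level (rotate x) ≡ level x
  level-rotate (plus _ _) = refl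
  level-rotate (minus _ _) = refl
  level-rotate (lft _) = refl
  level-rotate (rgt _) = refl
  level-rotate sl = refl
  level-rotate sr = refl
  level-rotate tl = refl
  level-rotate tr = refl

  block-rotate : ∀ {L} (x : SV d (suc L)) → block (rotate x) ≡ halfTurn (suc L) (block x)
  block-rotate {L} (plus i _) = trans (cong (λ c → suc (suc L + c)) (opposite-prop i))
    (sym (halfTurn-≤ (≤-trans (m∸n≤m L (toℕ i)) (n≤1+n L))))
  block-rotate {L} (minus i _) = begin
    L ∸ toℕ (opposite i)              ≡⟨ cong (L ∸_) (opposite-prop i) ⟩
    L ∸ (L ∸ toℕ i)                   ≡⟨ m∸[m∸n]≡n (s≤s⁻¹ (toℕ<n i)) ⟩
    toℕ i                             ≡⟨ sym (m+n∸m≡n L (toℕ i)) ⟩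
    L + toℕ i ∸ L                     ≡⟨ sym (halfTurn-> (s≤s (s≤s (m≤m+n L (toℕ i))))) ⟩
    halfTurn (suc L) (suc (suc L + toℕ i)) ∎
    where open ≡-Reasoning
  block-rotate {L} (lft _) = sym (halfTurn-≤ {suc L} ≤-refl)
  block-rotate {L} sl = sym (halfTurn-≤ {suc L} ≤-refl)
  block-rotate {L} tl = sym (halfTurn-≤ {suc L} ≤-refl)
  block-rotate {L} (rgt _) = trans (sym (m+n∸m≡n L (suc L))) (sym (halfTurn-> (ℓ<lastBlock (suc L))))
  block-rotate {L} sr = trans (sym (m+n∸m≡n L (suc L))) (sym (halfTurn-> (ℓ<lastBlock (suc L))))
  block-rotate {L} tr = trans (sym (m+n∸m≡n L (suc L))) (sym (halfTurn-> (ℓ<lastBlock (suc L))))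

  hom-id-or-rotate : ∀ {L} {f f' : SignMap d (suc L)} (h : Hom (S d (suc L) f) (S d (suc L) f')) →
                     (∀ x → proj₁ h x ≡ x) ⊎ (∀ x → proj₁ h x ≡ rotate x)
  hom-id-or-rotate h = Sum.map
    (λ same-block x → coordinates-injective (same-block x) (image-level x))
    (λ shifted x → coordinates-injective (trans (shifted x) (sym (block-rotate x)))
                                         (trans (image-level x) (sym (level-rotate x))))
    (hom-block h)
    where open HomImage h

  -- Entry j' of a SignMap stands for j = j' + 2, and v_j has index j' + 1.
  crossIndex : Fin (suc n) → Fin d
  crossIndex j = fsuc (inject₁ j)

  toℕ-crossIndex : (j : Fin (suc n)) → toℕ (crossIndex j) ≡ suc (toℕ j)
  toℕ-crossIndex j = cong suc (toℕ-inject₁ j)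

  toℕ-opposite-crossIndex : (j : Fin (suc n)) → toℕ (opposite (crossIndex j)) ≡ d ∸ (toℕ j + 2)
  toℕ-opposite-crossIndex j = trans (opposite-prop (crossIndex j))
    (trans (cong (λ c → d ∸ suc c) (toℕ-crossIndex j)) (cong (d ∸_) (+-comm 2 (toℕ j))))

  partner-level : (j : Fin (suc n)) → d ∸ (toℕ j + 2) ≡ suc (toℕ (opposite j))
  partner-level j = trans (cong (d ∸_) (+-comm (toℕ j) 2))
    (trans (+-∸-assoc 1 (s≤s⁻¹ (toℕ<n j))) (cong suc (sym (opposite-prop j))))

  partner-level-opposite : (j : Fin (suc n)) → suc (toℕ j) ≡ d ∸ (toℕ (opposite j) + 2)
  partner-level-opposite j =
    sym (trans (partner-level (opposite j)) (cong (suc ∘ toℕ) (opposite-involutive j)))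

  module _ {ℓ} {f : SignMap d ℓ} where

    upward-arc : ∀ {i j} → f i j ≡ pos → SArc d ℓ f (minus i (opposite (crossIndex j))) (plus i (crossIndex j))
    upward-arc {i} {j} f≡pos = fp i j _ _ f≡pos (toℕ-crossIndex j) (toℕ-opposite-crossIndex j)

    downward-arc : ∀ {i j} → f i j ≡ neg → SArc d ℓ f (plus i (crossIndex j)) (minus i (opposite (crossIndex j)))
    downward-arc {i} {j} f≡neg = fm i j _ _ f≡neg (toℕ-crossIndex j) (toℕ-opposite-crossIndex j)

    upward-sign : ∀ {i j a b} → SArc d ℓ f (minus i b) (plus i a) → toℕ a ≡ suc (toℕ j) → f i j ≡ pos
    upward-sign (fp _ _ _ _ f≡pos a≡' _) a≡ with toℕ-injective (suc-injective (trans (sym a≡') a≡))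
    ... | refl = f≡pos

    downward-sign : ∀ {i j a b} → SArc d ℓ f (plus i a) (minus i b) → toℕ a ≡ suc (toℕ j) → f i j ≡ neg
    downward-sign (fm _ _ _ _ f≡neg a≡' _) a≡ with toℕ-injective (suc-injective (trans (sym a≡') a≡))
    ... | refl = f≡neg

  module _ {ℓ} {f f' : SignMap d ℓ} where

    id-arc : Leq d f f' → ∀ {x y} → SArc d ℓ f x y → SArc d ℓ f' x y
    id-arc _ (tp i a b a<b) = tp i a b a<b
    id-arc _ (tm i a b a<b) = tm i a b a<b
    id-arc _ (tL a b a<b) = tL a b a<b
    id-arc _ (tR a b a<b) = tR a b a<b
    id-arc _ (sL u) = sL u
    id-arc _ (Lt u) = Lt u
    id-arc _ (sR u) = sR u
    id-arc _ (Rt u) = Rt u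
    id-arc _ (e1 i a i≡ a≡) = e1 i a i≡ a≡
    id-arc _ (e2 i b i≡ b≡) = e2 i b i≡ b≡
    id-arc _ (e3 i a i≡ a≡) = e3 i a i≡ a≡
    id-arc _ (e4 i b i≡ b≡) = e4 i b i≡ b≡
    id-arc _ (cp i i' a b i'≡ a≡ b≡) = cp i i' a b i'≡ a≡ b≡
    id-arc _ (cm i i' a b i'≡ a≡ b≡) = cm i i' a b i'≡ a≡ b≡
    id-arc f≤f' (fm i j a b f≡neg a≡ b≡) = fm i j a b (Leq-nonzero {d} f≤f' f≡neg λ ()) a≡ b≡
    id-arc f≤f' (fp i j a b f≡pos a≡ b≡) = fp i j a b (Leq-nonzero {d} f≤f' f≡pos λ ()) a≡ b≡

    rotate-arc : Leq d (inv d f) f' → ∀ {x y} → SArc d ℓ f x y → SArc d ℓ f' (rotate x) (rotate y)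
    rotate-arc _ (tp i a b a<b) = tm (opposite i) a b a<b
    rotate-arc _ (tm i a b a<b) = tp (opposite i) a b a<b
    rotate-arc _ (tL a b a<b) = tR a b a<b
    rotate-arc _ (tR a b a<b) = tL a b a<b
    rotate-arc _ (sL u) = sR u
    rotate-arc _ (Lt u) = Rt u
    rotate-arc _ (sR u) = sL u
    rotate-arc _ (Rt u) = Lt u
    rotate-arc _ (e1 i a i≡0 a≡) = e3 (opposite i) a (opposite-first i i≡0) a≡
    rotate-arc _ (e2 i b i≡0 b≡) = e4 (opposite i) b (opposite-first i i≡0) b≡
    rotate-arc _ (e3 i a i≡last a≡) = e1 (opposite i) a (opposite-last i i≡last) a≡
    rotate-arc _ (e4 i b i≡last b≡) = e2 (opposite i) b (opposite-last i i≡last) b≡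
    rotate-arc _ (cp i i' a b i'≡ a≡ b≡) = cm (opposite i') (opposite i) a b (opposite-suc i i' i'≡) a≡ b≡
    rotate-arc _ (cm i i' a b i'≡ a≡ b≡) = cp (opposite i') (opposite i) a b (opposite-suc i i' i'≡) a≡ b≡
    rotate-arc inv≤f' (fm i j a b f≡neg a≡ b≡) =
      fp (opposite i) (opposite j) b a (inv-nonzero {d} {f = f} inv≤f' {i} {j} f≡neg λ ())
         (trans b≡ (partner-level j)) (trans a≡ (partner-level-opposite j))
    rotate-arc inv≤f' (fp i j a b f≡pos a≡ b≡) =
      fm (opposite i) (opposite j) b a (inv-nonzero {d} {f = f} inv≤f' {i} {j} f≡pos λ ())
         (trans b≡ (partner-level j)) (trans a≡ (partner-level-opposite j))

    id-hom : Leq d f f' → Hom (S d ℓ f) (S d ℓ f')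
    id-hom f≤f' = (λ x → x) , id-arc f≤f'

    rotate-hom : Leq d (inv d f) f' → Hom (S d ℓ f) (S d ℓ f')
    rotate-hom inv≤f' = rotate , rotate-arc inv≤f'

    arc-along : ∀ {g : SV d ℓ → SV d ℓ} (h : Hom (S d ℓ f) (S d ℓ f')) → (∀ x → proj₁ h x ≡ g x) →
                ∀ {x y} → SArc d ℓ f x y → SArc d ℓ f' (g x) (g y)
    arc-along h h≡g arc = subst₂ (SArc d ℓ f') (h≡g _) (h≡g _) (proj₂ h arc)

    id-hom⇒Leq : (h : Hom (S d ℓ f) (S d ℓ f')) → (∀ x → proj₁ h x ≡ x) → Leq d f f'
    id-hom⇒Leq h h≡id = refl , λ i i' j i≡i' → sign≤ i j (toℕ-injective i≡i')
      where
      sign≤ : ∀ i j {i'} → i ≡ i' → f i j ≡ zer ⊎ f i j ≡ f' i' j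
      sign≤ i j refl with f i j in f≡
      ... | zer = inj₁ refl
      ... | pos = inj₂ (sym (upward-sign (arc-along h h≡id (upward-arc f≡)) (toℕ-crossIndex j)))
      ... | neg = inj₂ (sym (downward-sign (arc-along h h≡id (downward-arc f≡)) (toℕ-crossIndex j)))

    rotate-hom⇒Leq : (h : Hom (S d ℓ f) (S d ℓ f')) → (∀ x → proj₁ h x ≡ rotate x) → Leq d (inv d f) f'
    rotate-hom⇒Leq h h≡rotate = refl , λ i i' j i≡i' → sign≤ i j (toℕ-injective i≡i')
      where
      level≡ : ∀ j → toℕ (opposite (crossIndex (opposite j))) ≡ suc (toℕ j)
      level≡ j = trans (toℕ-opposite-crossIndex (opposite j)) (sym (partner-level-opposite j))
      sign≤ : ∀ i j {i'} → i ≡ i' → inv d f i j ≡ zer ⊎ inv d f i j ≡ f' i' j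
      sign≤ i j refl with f (opposite i) (opposite j) in f≡
      ... | zer = inj₁ refl
      ... | pos = inj₂ (sym (subst (λ i″ → f' i″ j ≡ neg) (opposite-involutive i)
                        (downward-sign (arc-along h h≡rotate (upward-arc f≡)) (level≡ j))))
      ... | neg = inj₂ (sym (subst (λ i″ → f' i″ j ≡ pos) (opposite-involutive i)
                        (upward-sign (arc-along h h≡rotate (downward-arc f≡)) (level≡ j))))

  module _ {L L' : ℕ} {f : SignMap d (suc L)} {f' : SignMap d (suc L')} where

    Hom⇒Leq : Hom (S d (suc L) f) (S d (suc L') f') → Leq d f f' ⊎ Leq d (inv d f) f'
    Hom⇒Leq h with hom-length h
    ... | refl = Sum.map (id-hom⇒Leq h) (rotate-hom⇒Leq h) (hom-id-or-rotate h)

    homCount-2 : Leq d f f' → Leq d (inv d f) f' → HomCount (S d (suc L) f) (S d (suc L') f') 2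
    homCount-2 f≤f'@(refl , _) inv≤f' =
      Fin2-bijection (HomSetoid (S d (suc L) f) (S d (suc L) f')) (id-hom f≤f') (rotate-hom inv≤f')
        (λ id≈rotate → sl≢sr (id≈rotate sl))
        (λ h → Sum.map (λ h≡id x → sym (h≡id x)) (λ h≡rotate x → sym (h≡rotate x)) (hom-id-or-rotate h))
      where
      sl≢sr : sl ≢ sr
      sl≢sr ()

    homCount-1 : Leq d f f' ⊎ Leq d (inv d f) f' → ¬ (Leq d f f' × Leq d (inv d f) f') →
                 HomCount (S d (suc L) f) (S d (suc L') f') 1
    homCount-1 (inj₁ f≤f'@(refl , _)) ¬both =
      Fin1-bijection (HomSetoid (S d (suc L) f) (S d (suc L) f')) (id-hom f≤f') unique
      where
      unique : ∀ h → ∀ x → x ≡ proj₁ h x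
      unique h with hom-id-or-rotate h
      ... | inj₁ h≡id = λ x → sym (h≡id x)
      ... | inj₂ h≡rotate = ⊥-elim (¬both (f≤f' , rotate-hom⇒Leq h h≡rotate))
    homCount-1 (inj₂ inv≤f'@(refl , _)) ¬both =
      Fin1-bijection (HomSetoid (S d (suc L) f) (S d (suc L) f')) (rotate-hom inv≤f') unique
      where
      unique : ∀ h → ∀ x → rotate x ≡ proj₁ h x
      unique h with hom-id-or-rotate h
      ... | inj₁ h≡id = ⊥-elim (¬both (id-hom⇒Leq h h≡id , inv≤f'))
      ... | inj₂ h≡rotate = λ x → sym (h≡rotate x)

    homCount-0 : ¬ Leq d f f' → ¬ Leq d (inv d f) f' → HomCount (S d (suc L) f) (S d (suc L') f') 0
    homCount-0 ¬id ¬rotate =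
      Fin0-bijection (HomSetoid (S d (suc L) f) (S d (suc L') f')) λ h → [ ¬id , ¬rotate ] (Hom⇒Leq h)

lemma4p1 : (d ℓ ℓ' : ℕ) → 3 ≤ d → 1 ≤ ℓ → 1 ≤ ℓ' →
           (f : SignMap d ℓ) (f' : SignMap d ℓ') →
           ((Leq d f f' × Leq d (inv d f) f') → HomCount (S d ℓ f) (S d ℓ' f') 2)
           × ((Leq d f f' ⊎ Leq d (inv d f) f') → ¬ (Leq d f f' × Leq d (inv d f) f') →
                HomCount (S d ℓ f) (S d ℓ' f') 1)
           × (¬ Leq d f f' → ¬ Leq d (inv d f) f' → HomCount (S d ℓ f) (S d ℓ' f') 0)
lemma4p1 _ _ _ (s≤s (s≤s (s≤s _))) (s≤s _) (s≤s _) f f' =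
  (λ (f≤f' , inv≤f') → homCount-2 _ f≤f' inv≤f') , homCount-1 _ , homCount-0 _
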